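{- Let $a\ge 2$ be even and let $c$ be an integer with $c\ne a$ and $\frac a2<c$. Then $U=\{(a,-a),(c,-c)\}\subseteq\mathcal{B}$ is unavoidable in $\mathcal{B}$.
   Context: The bicyclic inverse semigroup is $\mathcal{B}=\{(a,b)\in\mathbb{Z}\times\mathbb{Z}\mid a\ge 0,\ a+b\ge 0\}$ with multiplication $(a,b)(c,d)=(\max\{c+d,a\}-d,\ b+d)$. A subset $U\subseteq\mathcal{B}$ is avoidable if $\mathcal{B}$ can be partitioned into two sets $A$ and $B$ such that no element of $U$ is a product $st$ of two distinct elements $s\ne t$ both in $A$ or both in $B$; otherwise $U$ is unavoidable. -}

module Defs where

open import Data.Integer using (ℤ; +_; _+_; _-_; -_; _≤_; _⊔_)
open import Data.Bool using (Bool)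
open import Data.Product using (Σ; _×_; _,_; proj₁; ∃)
open import Relation.Binary.PropositionalEquality using (_≡_)
open import Relation.Nullary using (¬_)

Pair : Set
Pair = ℤ × ℤ

-- membership in the bicyclic inverse semigroup: a ≥ 0 and a + b ≥ 0
InB : Pair → Set
InB (a , b) = (+ 0 ≤ a) × (+ 0 ≤ a + b)

_·_ : Pair → Pair → Pair
(a , b) · (c , d) = (((c + d) ⊔ a) - d , b + d)

-- U ⊆ 𝓑 is avoidable: there is a partition of 𝓑 into two sets
-- (given by a 2-colouring of 𝓑) such that no element of U is a product
-- s t of two distinct elements s ≠ t of 𝓑 of the same colour.
Avoidable : (Pair → Set) → Set
Avoidable U =
  Σ (Pair → Bool) λ colour →
    ∀ s t → InB s → InB t → ¬ (s ≡ t) → colour s ≡ colour t → ¬ U (s · t)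

Unavoidable : (Pair → Set) → Set
Unavoidable U = ¬ Avoidable U

module Submission where

-- Idea: a set U is unavoidable as soon as 𝓑 contains a "U-triangle": three
-- pairwise distinct elements p, q, r whose products p·q, p·r, q·r all lie in
-- U.  Indeed, any 2-colouring gives two of the three the same colour
-- (pigeonhole), and their product is then a forbidden monochromatic product.
--
-- The hypothesis
-- a < 2c gives k < c, which makes all three lie in 𝓑 and pairwise distinct
-- (together with c ≠ 2k).

open import Defs
open import Data.Integer using (ℤ; +_; -_; _*_; _<_; _≤_)
open import Data.Product using (_,_; ∃)
open import Data.Sum using (_⊎_)
open import Relation.Binary.PropositionalEquality using (_≡_)
open import Relation.Nullary using (¬_)

open import Data.Bool using (Bool; true; false)
open import Data.Empty using (⊥)
open import Data.Integer using (0ℤ; _+_; _-_; _⊓_; +<+)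
open import Data.Integer.Properties
open import Data.Integer.Tactic.RingSolver using (solve-∀)
open import Data.Nat using (s≤s; z≤n)
open import Data.Product using (proj₁; proj₂)
open import Data.Sum using (inj₁; inj₂)
open import Relation.Binary.PropositionalEquality
  using (refl; sym; trans; cong; cong₂; subst; module ≡-Reasoning)

pigeonhole : (x y z : Bool) → (x ≡ y) ⊎ (x ≡ z) ⊎ (y ≡ z)
pigeonhole false false _     = inj₁ refl
pigeonhole true  true  _     = inj₁ refl
pigeonhole false true  false = inj₂ (inj₁ refl)
pigeonhole true  false true  = inj₂ (inj₁ refl)
pigeonhole false true  true  = inj₂ (inj₂ refl)
pigeonhole true  false false = inj₂ (inj₂ refl)

record Triangle (U : Pair → Set) : Set where
  field
    p q r : Pair
    p∈𝓑 : InB p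
    q∈𝓑 : InB q
    r∈𝓑 : InB r
    p≢q : ¬ (p ≡ q)
    p≢r : ¬ (p ≡ r)
    q≢r : ¬ (q ≡ r)
    pq∈U : U (p · q)
    pr∈U : U (p · r)
    qr∈U : U (q · r)

triangle⇒unavoidable : {U : Pair → Set} → Triangle U → Unavoidable U
triangle⇒unavoidable t (colour , avoids) = monochromatic (pigeonhole (colour p) (colour q) (colour r))
  where
  open Triangle t
  monochromatic : (colour p ≡ colour q) ⊎ (colour p ≡ colour r) ⊎ (colour q ≡ colour r) → ⊥
  monochromatic (inj₁ pq)        = avoids p q p∈𝓑 q∈𝓑 p≢q pq pq∈U
  monochromatic (inj₂ (inj₁ pr)) = avoids p r p∈𝓑 r∈𝓑 p≢r pr pr∈U
  monochromatic (inj₂ (inj₂ qr)) = avoids q r q∈𝓑 r∈𝓑 q≢r qr qr∈U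

·-when-≤ : {a b c d : ℤ} → c + d ≤ a → (a , b) · (c , d) ≡ (a - d , b + d)
·-when-≤ {a} {b} {c} {d} c+d≤a = cong (λ m → (m - d , b + d)) (i≤j⇒i⊔j≡j c+d≤a)

diag : ℤ → Pair
diag n = (n , - n)

diag∈𝓑 : {n : ℤ} → 0ℤ ≤ n → InB (diag n)
diag∈𝓑 {n} 0≤n = 0≤n , ≤-reflexive (sym (+-inverseʳ n))

diag-· : (x t y : ℤ) → t - y ≤ x → diag x · (t , - y) ≡ diag (x + y)
diag-· x t y t-y≤x = begin
  diag x · (t , - y)      ≡⟨ ·-when-≤ {x} { - x} {t} { - y} t-y≤x ⟩
  (x - - y , - x + - y)   ≡⟨ cong₂ _,_ (cong (λ z → x + z) (neg-involutive y)) (sym (neg-distrib-+ x y)) ⟩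
  diag (x + y)            ∎
  where open ≡-Reasoning

minus-plus : (c k : ℤ) → (c - k) + k ≡ c
minus-plus = solve-∀

plus-minus : (k c : ℤ) → k + (c - k) ≡ c
plus-minus = solve-∀

double-minus : (k : ℤ) → (k + k) - k ≡ k
double-minus = solve-∀

twice : (k : ℤ) → + 2 * k ≡ k + k
twice = solve-∀

half-difference : {c k : ℤ} → c - k ≡ k → c ≡ k + k
half-difference {c} {k} c-k≡k = trans (sym (minus-plus c k)) (cong (_+ k) c-k≡k)

evenTriangle : {a k c : ℤ} → a ≡ k + k → 0ℤ < k → k < c → ¬ (c ≡ a) →
               Triangle (λ p → (p ≡ diag a) ⊎ (p ≡ diag c))
evenTriangle {k = k} {c} refl 0<k k<c c≢a = record
  { p = diag k ; q = diag (c - k) ; r = (t , - k)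
  ; p∈𝓑 = diag∈𝓑 0≤k
  ; q∈𝓑 = diag∈𝓑 (i≤j⇒0≤j-i (<⇒≤ k<c))
  ; r∈𝓑 = ≤-trans 0≤k (<⇒≤ k<t) , i≤j⇒0≤j-i (<⇒≤ k<t)
  ; p≢q = λ e → c≢a (half-difference (sym (cong proj₁ e)))
  ; p≢r = λ e → <-irrefl (cong proj₁ e) k<t
  ; q≢r = λ e → c≢a (half-difference (neg-injective (cong proj₂ e)))
  ; pq∈U = inj₂ p·q≡diag-c
  ; pr∈U = inj₁ p·r≡diag-a
  ; qr∈U = inj₂ q·r≡diag-c
  }
  where
  t : ℤ
  t = c ⊓ (k + k)

  0≤k : 0ℤ ≤ k
  0≤k = <⇒≤ 0<k

  k<t : k < t
  k<t with ⊓-sel c (k + k)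
  ... | inj₁ t≡c  = subst (k <_) (sym t≡c) k<c
  ... | inj₂ t≡2k = subst (k <_) (sym t≡2k)
                      (subst (_< k + k) (+-identityʳ k) (+-monoʳ-< k 0<k))

  p·q≡diag-c : diag k · diag (c - k) ≡ diag c
  p·q≡diag-c = trans (diag-· k (c - k) (c - k) (≤-trans (≤-reflexive (+-inverseʳ (c - k))) 0≤k))
                     (cong diag (plus-minus k c))

  -- uses t ≤ 2k, i.e. t - k ≤ k
  p·r≡diag-a : diag k · (t , - k) ≡ diag (k + k)
  p·r≡diag-a = diag-· k t k (≤-trans (+-monoˡ-≤ (- k) (i⊓j≤j c (k + k))) (≤-reflexive (double-minus k)))

  -- uses t ≤ c, i.e. t - k ≤ c - k
  q·r≡diag-c : diag (c - k) · (t , - k) ≡ diag c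
  q·r≡diag-c = trans (diag-· (c - k) t k (+-monoˡ-≤ (- k) (i⊓j≤i c (k + k))))
                     (cong diag (minus-plus c k))

mainTheorem4 : (a c : ℤ) → + 2 ≤ a → (∃ λ k → a ≡ + 2 * k) → ¬ (c ≡ a) → a < + 2 * c →
    Unavoidable (λ p → (p ≡ (a , - a)) ⊎ (p ≡ (c , - c)))
mainTheorem4 a c 2≤a (k , a≡2k) c≢a a<2c =
  triangle⇒unavoidable (evenTriangle (trans a≡2k (twice k)) 0<k k<c c≢a)
  where
  0<k : 0ℤ < k
  0<k = *-cancelˡ-<-nonNeg (+ 2) (subst (0ℤ <_) a≡2k (<-≤-trans (+<+ (s≤s z≤n)) 2≤a))

  k<c : k < c
  k<c = *-cancelˡ-<-nonNeg (+ 2) (subst (_< + 2 * c) a≡2k a<2c)
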